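{- Let $n\ge 4$ be even, let $a$ be an integer such that $r^a$ generates the cyclic subgroup $\langle r\rangle$ of order $n$, and let $S=\{f,r^af,r^{n/2}\}\subseteq D_n$. Then (a) $\lambda_1(D_n,S)=\frac{n}{2}$ and (b) $\lambda_2(D_n,S)=\lambda_1(D_n,S)$.
   Context: The dihedral group $D_n$ is the group of order $2n$ with presentation $\langle r,f\mid r^n=f^2=1,\ rf=fr^{ -1}\rangle$. For a generating set $S$ of a finite group $G$ and $g\in G$, $l_S(g)$ is the minimal number of factors in an expression of $g$ as a product of elements of $S$ ($l_S(1)=0$). Define $\lambda_1(G,S)=\max_{g\in G,\,s\in S} l_S(gsg^{ -1})$ and $\lambda_2(G,S)=\max_{g\in G,\,s,s'\in S} l_S(gss'g^{ -1})$. -}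

module Defs where

open import Data.Nat using (ℕ; zero; suc; _+_; _∸_; _≤_; NonZero)
open import Data.Nat.DivMod using (_mod_)
open import Data.Fin using (Fin; toℕ)
open import Data.Bool using (Bool; true; false; _xor_)
open import Data.Integer using (ℤ; +_; -[1+_])
open import Data.Product using (_×_; _,_; Σ; ∃)
open import Data.List using (List; []; _∷_; length; foldr)
open import Data.List.Membership.Propositional using (_∈_)
open import Relation.Binary.PropositionalEquality using (_≡_)

-- The dihedral group D_n (order 2n), modelled concretely:
-- the pair (k , b) stands for r^k f^b, with k ∈ ℤ/nℤ (as Fin n) and b ∈ {0,1}.
-- Multiplication follows from r^n = f^2 = 1, r f = f r⁻¹ (equivalently f r^j = r^{-j} f):
--   (r^k f^b)(r^j f^c) = r^{k + (±j)} f^{b xor c}, with sign - iff b = 1.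
module Dihedral (n : ℕ) .{{_ : NonZero n}} where

  D : Set
  D = Fin n × Bool

  negMod : Fin n → ℕ
  negMod j = n ∸ toℕ j

  _·_ : D → D → D
  (k , false) · (j , c) = ((toℕ k + toℕ j) mod n) , c
  (k , true)  · (j , c) = ((toℕ k + negMod j) mod n) , (true xor c)

  e : D
  e = (0 mod n) , false

  r : D
  r = (1 mod n) , false

  f : D
  f = (0 mod n) , true

  inv : D → D
  inv (k , false) = (negMod k mod n) , false
  inv (k , true)  = k , true

  pow : D → ℕ → D
  pow g zero    = e
  pow g (suc m) = g · pow g m

  zpow : D → ℤ → D
  zpow g (+ m)      = pow g m
  zpow g -[1+ m ]   = pow (inv g) (suc m)

  prod : List D → D
  prod = foldr _·_ e

  WordLength : List D → D → ℕ → Set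
  WordLength S g k =
    (Σ (List D) λ w → (∀ {x} → x ∈ w → x ∈ S) × length w ≡ k × prod w ≡ g)
    × (∀ (w : List D) → (∀ {x} → x ∈ w → x ∈ S) → prod w ≡ g → k ≤ length w)

  Lambda1 : List D → ℕ → Set
  Lambda1 S m =
    (∀ (g s : D) (k : ℕ) → s ∈ S → WordLength S (g · (s · inv g)) k → k ≤ m)
    × (Σ D λ g → Σ D λ s → s ∈ S × WordLength S (g · (s · inv g)) m)

  Lambda2 : List D → ℕ → Set
  Lambda2 S m =
    (∀ (g s s' : D) (k : ℕ) → s ∈ S → s' ∈ S →
       WordLength S (g · ((s · s') · inv g)) k → k ≤ m)
    × (Σ D λ g → Σ D λ s → Σ D λ s' → s ∈ S × s' ∈ S ×
         WordLength S (g · ((s · s') · inv g)) m)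

  GeneratesRotations : D → Set
  GeneratesRotations x = ∀ (k : ℕ) → ∃ λ (m : ℕ) → pow x m ≡ pow r k

-- Since a is a unit modulo n, every element is ρ^x f^b with ρ = r^a; give it the position 2x − b,
-- an integer well defined modulo 2n. The generators f and ρf act on positions as the reflections
-- p ↦ −1 − p and p ↦ 1 − p, and z = r^(n/2) as the translation p ↦ p + n. Hence the product of a
-- word of length L sits at a position q + e·n with e ∈ {0,1} and |q| + e ≤ L; conversely,
-- alternating words in f and ρf, preceded by z if necessary, reach every position within n/2 steps.
-- So every element has length at most n/2, while the reflection at the odd position closest to
-- n/2 has length exactly n/2. That reflection is conjugate by a rotation both to f or ρf and to
-- f·z or ρf·z, which gives both maxima.
module Submission where

open import Defs
open import Data.Nat using (ℕ; zero; suc; _≤_; _<_; _/_; NonZero; z≤n; s≤s)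
import Data.Nat as ℕ
import Data.Nat.Properties as ℕP
import Data.Nat.DivMod as ℕ÷
open import Data.Nat.Divisibility using (_∣_)
open import Data.Integer using (ℤ; +_; -[1+_]; +0; +[1+_]; _+_; _-_; -_; _*_; ∣_∣; 0ℤ; 1ℤ)
import Data.Integer.Properties as ℤP
open import Data.Integer.DivMod using (_%ℕ_; _/ℕ_; n%ℕd<d; a≡a%ℕn+[a/ℕn]*n)
open import Data.Integer.Tactic.RingSolver using (solve-∀)
open import Data.Fin using (Fin; toℕ; fromℕ<)
import Data.Fin.Properties as FinP
open import Data.Bool using (Bool; true; false; not)
open import Data.Product using (Σ; _×_; _,_; proj₁; proj₂)
open import Data.List using (List; []; _∷_; length)
open import Data.List.Membership.Propositional using (_∈_)
open import Data.List.Relation.Binary.Subset.Propositional using (_⊆_)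
open import Data.List.Relation.Unary.Any using (here; there)
open import Relation.Binary.PropositionalEquality
open import Relation.Nullary using (¬_; yes; no)
open import Data.Sum using (_⊎_; inj₁; inj₂)
import Data.Nat.Tactic.RingSolver as ℕSolver
open import Relation.Binary.Bundles using (Setoid)
import Relation.Binary.Reasoning.Setoid as SetoidReasoning
open import Level using (0ℓ)
open import Data.Empty using (⊥-elim)

-- Congruences of integers

infix 4 _≡_mod_
data _≡_mod_ (x y m : ℤ) : Set where
  multiple : (k : ℤ) → x ≡ y + k * m → x ≡ y mod m

module _ {m : ℤ} where

  mod-reflexive : ∀ {x y} → x ≡ y → x ≡ y mod m
  mod-reflexive {x} refl = multiple 0ℤ (lemma x m)
    where lemma : ∀ x m → x ≡ x + 0ℤ * m
          lemma = solve-∀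

  mod-refl : ∀ {x} → x ≡ x mod m
  mod-refl = mod-reflexive refl

  mod-sym : ∀ {x y} → x ≡ y mod m → y ≡ x mod m
  mod-sym {x} {y} (multiple k refl) = multiple (- k) (lemma y k m)
    where lemma : ∀ y k m → y ≡ (y + k * m) + - k * m
          lemma = solve-∀

  mod-trans : ∀ {x y z} → x ≡ y mod m → y ≡ z mod m → x ≡ z mod m
  mod-trans {z = z} (multiple k refl) (multiple l refl) = multiple (l + k) (lemma z k l m)
    where lemma : ∀ z k l m → (z + l * m) + k * m ≡ z + (l + k) * m
          lemma = solve-∀

  +-cong-mod : ∀ {x y u v} → x ≡ y mod m → u ≡ v mod m → x + u ≡ y + v mod m
  +-cong-mod {y = y} {v = v} (multiple k refl) (multiple l refl) = multiple (k + l) (lemma y v k l m)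
    where lemma : ∀ y v k l m → (y + k * m) + (v + l * m) ≡ (y + v) + (k + l) * m
          lemma = solve-∀

  neg-cong-mod : ∀ {x y} → x ≡ y mod m → - x ≡ - y mod m
  neg-cong-mod {y = y} (multiple k refl) = multiple (- k) (lemma y k m)
    where lemma : ∀ y k m → - (y + k * m) ≡ - y + - k * m
          lemma = solve-∀

  *-congʳ-mod : ∀ {x y} c → x ≡ y mod m → x * c ≡ y * c mod m
  *-congʳ-mod {y = y} c (multiple k refl) = multiple (k * c) (lemma y k c m)
    where lemma : ∀ y k c m → (y + k * m) * c ≡ y * c + (k * c) * m
          lemma = solve-∀

scale-mod : ∀ {x y m} c → x ≡ y mod m → c * x ≡ c * y mod (c * m)
scale-mod {y = y} {m} c (multiple k refl) = multiple k (lemma c y k m)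
  where lemma : ∀ c y k m → c * (y + k * m) ≡ c * y + k * (c * m)
        lemma = solve-∀

mod-setoid : ℤ → Setoid 0ℓ 0ℓ
mod-setoid m = record
  { Carrier       = ℤ
  ; _≈_           = λ x y → x ≡ y mod m
  ; isEquivalence = record { refl = mod-refl ; sym = mod-sym ; trans = mod-trans }
  }

module ModReasoning (m : ℤ) = SetoidReasoning (mod-setoid m)

%ℕ-mod : ∀ x m .{{_ : NonZero m}} → + (x %ℕ m) ≡ x mod + m
%ℕ-mod x m = mod-sym (multiple (x /ℕ m) (a≡a%ℕn+[a/ℕn]*n x m))

pos-+-* : ∀ b k n → + (b ℕ.+ k ℕ.* n) ≡ + b + + k * + n
pos-+-* b k n = trans (ℤP.pos-+ b (k ℕ.* n)) (cong (λ t → + b + t) (ℤP.pos-* k n))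

module _ {n : ℕ} .{{_ : NonZero n}} where

  residues-differing-by : ∀ k {a b} → a < n → b < n → + a ≡ + b + + k * + n → a ≡ b
  residues-differing-by k {a} {b} a<n b<n eq = begin
    a                 ≡⟨ ℕ÷.m<n⇒m%n≡m a<n ⟨
    a ℕ.% n           ≡⟨ cong (ℕ._% n) (ℤP.+-injective (trans eq (sym (pos-+-* b k n)))) ⟩
    (b ℕ.+ k ℕ.* n) ℕ.% n ≡⟨ ℕ÷.[m+kn]%n≡m%n b k n ⟩
    b ℕ.% n           ≡⟨ ℕ÷.m<n⇒m%n≡m b<n ⟩
    b                 ∎
    where open ≡-Reasoning

  residue-unique : ∀ {a b} → a < n → b < n → + a ≡ + b mod + n → a ≡ b
  residue-unique a<n b<n (multiple (+ k) eq) = residues-differing-by k a<n b<n eq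
  residue-unique {a} {b} a<n b<n (multiple -[1+ k ] eq) =
    sym (residues-differing-by (suc k) b<n a<n (trans (lemma (+ b) (+ suc k) (+ n)) (cong (_+ + suc k * + n) (sym eq))))
    where lemma : ∀ b k n → b ≡ (b + - k * n) + k * n
          lemma = solve-∀

least-residue-shift : ∀ {c m} k → 1 ≤ ∣ k ∣ → ∣ c ∣ ≤ m → ∣ c ∣ ≤ ∣ c + k * (+ 2 * + m) ∣
least-residue-shift {c} {m} k 1≤∣k∣ c≤m = ℕP.≤-trans c≤m (ℕP.+-cancelʳ-≤ m m ∣ c + kT ∣ (begin
  m ℕ.+ m                     ≡⟨ cong (m ℕ.+_) (ℕP.+-identityʳ m) ⟨
  2 ℕ.* m                     ≡⟨ ℕP.*-identityˡ (2 ℕ.* m) ⟨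
  1 ℕ.* (2 ℕ.* m)             ≤⟨ ℕP.*-monoˡ-≤ (2 ℕ.* m) 1≤∣k∣ ⟩
  ∣ k ∣ ℕ.* (2 ℕ.* m)         ≡⟨ cong (∣ k ∣ ℕ.*_) (ℤP.abs-* (+ 2) (+ m)) ⟨
  ∣ k ∣ ℕ.* ∣ + 2 * + m ∣     ≡⟨ ℤP.abs-* k (+ 2 * + m) ⟨
  ∣ kT ∣                      ≡⟨ cong ∣_∣ (lemma c kT) ⟩
  ∣ (c + kT) - c ∣            ≤⟨ ℤP.∣i-j∣≤∣i∣+∣j∣ (c + kT) c ⟩
  ∣ c + kT ∣ ℕ.+ ∣ c ∣         ≤⟨ ℕP.+-monoʳ-≤ ∣ c + kT ∣ c≤m ⟩
  ∣ c + kT ∣ ℕ.+ m             ∎))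
  where open ℕP.≤-Reasoning
        kT = k * (+ 2 * + m)
        lemma : ∀ c t → t ≡ (c + t) - c
        lemma = solve-∀

least-residue : ∀ {c q m} → ∣ c ∣ ≤ m → q ≡ c mod (+ 2 * + m) → ∣ c ∣ ≤ ∣ q ∣
least-residue {c} c≤m (multiple +0 refl) = ℕP.≤-reflexive (cong ∣_∣ (sym (ℤP.+-identityʳ c)))
least-residue {c} c≤m (multiple k@(+[1+ _ ]) refl) = least-residue-shift {c} k (s≤s z≤n) c≤m
least-residue {c} c≤m (multiple k@(-[1+ _ ]) refl) = least-residue-shift {c} k (s≤s z≤n) c≤m

bit : Bool → ℕ
bit false = 0
bit true  = 1

bit-not : ∀ b → + bit (not b) ≡ 1ℤ - + bit b
bit-not false = refl
bit-not true  = refl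

parity : ∀ k → Σ ℕ λ x → Σ Bool λ c → k ≡ bit c ℕ.+ 2 ℕ.* x
parity zero = 0 , false , refl
parity (suc zero) = 0 , true , refl
parity (suc (suc k)) with parity k
... | x , c , refl = suc x , c , lemma (bit c) x
  where lemma : ∀ b x → suc (suc (b ℕ.+ 2 ℕ.* x)) ≡ b ℕ.+ 2 ℕ.* suc x
        lemma = ℕSolver.solve-∀

twice≢1 : ∀ z → + 2 * z ≢ 1ℤ
twice≢1 z 2z≡1 = ℕP.even≢odd ∣ z ∣ 0 (trans (sym (ℤP.abs-* (+ 2) z)) (cong ∣_∣ 2z≡1))

twice-injective : ∀ {x y k} → + 2 * x - k ≡ + 2 * y - k → x ≡ y
twice-injective {x} {y} {k} eq = ℤP.*-cancelˡ-≡ (+ 2) x y (trans (lemma x k) (trans (cong (_+ k) eq) (sym (lemma y k))))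
  where lemma : ∀ x k → + 2 * x ≡ + 2 * x - k + k
        lemma = solve-∀

even-non-unit : ∀ {u v m} → ¬ (u * (+ 2 * v) ≡ 1ℤ mod (+ 2 * m))
even-non-unit {u} {v} {m} (multiple k 2uv≡1+2km) =
  twice≢1 (u * v - k * m) (trans (lemma u v k m) (trans (cong (_- k * (+ 2 * m)) 2uv≡1+2km) (lemma′ k m)))
  where lemma : ∀ u v k m → + 2 * (u * v - k * m) ≡ u * (+ 2 * v) - k * (+ 2 * m)
        lemma = solve-∀
        lemma′ : ∀ k m → 1ℤ + k * (+ 2 * m) - k * (+ 2 * m) ≡ 1ℤ
        lemma′ = solve-∀

-- A unit modulo 2h is odd.
unit-fixes-half : ∀ {h M a} → + M * a ≡ 1ℤ mod (+ 2 * + h) → + h * a ≡ + h mod (+ 2 * + h)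
unit-fixes-half {h} {M} {a} Ma≡1 with a %ℕ 2 | n%ℕd<d a 2 | a≡a%ℕn+[a/ℕn]*n a 2
... | 0 | _ | a≡0+2b =
  ⊥-elim (even-non-unit {+ M} {a /ℕ 2} {+ h} (subst (λ t → + M * t ≡ 1ℤ mod (+ 2 * + h)) a≡2b Ma≡1))
  where a≡2b : a ≡ + 2 * (a /ℕ 2)
        a≡2b = trans a≡0+2b (lemma (a /ℕ 2))
          where lemma : ∀ b → + 0 + b * + 2 ≡ + 2 * b
                lemma = solve-∀
... | 1 | _ | a≡2b+1 = multiple (a /ℕ 2) (trans (cong (+ h *_) a≡2b+1) (lemma (+ h) (a /ℕ 2)))
  where lemma : ∀ h b → h * (+ 1 + b * + 2) ≡ h + b * (+ 2 * h)
        lemma = solve-∀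
... | suc (suc _) | s≤s (s≤s ()) | _

positive-half : ∀ {n h} → 0 < n → n ≡ h ℕ.+ h → 1 ≤ h
positive-half {h = zero}  () refl
positive-half {h = suc _} _  _ = s≤s z≤n

odd-neighbour : ∀ h → Σ ℕ λ m → h ≤ suc (2 ℕ.* m) × suc (2 ℕ.* m) ≤ suc h
odd-neighbour h with parity h
... | m , false , refl = m , ℕP.n≤1+n _ , ℕP.≤-refl
... | m , true  , refl = m , ℕP.≤-refl , ℕP.n≤1+n _

half-double : ∀ {n} → 2 ∣ n → n ≡ n / 2 ℕ.+ n / 2
half-double {n} 2∣n = trans (sym (ℕ÷.m/n*n≡m 2∣n)) (lemma (n / 2))
  where lemma : ∀ x → x ℕ.* 2 ≡ x ℕ.+ x
        lemma = ℕSolver.solve-∀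

≤-double : ∀ {h n P} → n ≡ h ℕ.+ h → 1 ≤ h → P ≤ suc h → P ≤ n
≤-double {h} n≡h+h 1≤h P≤1+h =
  ℕP.≤-trans P≤1+h (ℕP.≤-trans (ℕP.+-monoˡ-≤ h 1≤h) (ℕP.≤-reflexive (sym n≡h+h)))

cost-lower-bound : ∀ {h n P} q e → n ≡ h ℕ.+ h → 1 ≤ h → h ≤ P → P ≤ suc h →
                   q + + bit e * + n ≡ + P mod (+ 2 * + n) → h ≤ ∣ q ∣ ℕ.+ bit e
cost-lower-bound {h} {n} {P} q false n≡h+h 1≤h h≤P P≤1+h q+en≡P =
  ℕP.≤-trans h≤P (ℕP.≤-trans (least-residue (≤-double n≡h+h 1≤h P≤1+h) q≡P) (ℕP.m≤m+n ∣ q ∣ 0))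
  where q≡P : q ≡ + P mod (+ 2 * + n)
        q≡P = mod-trans (mod-reflexive (sym (ℤP.+-identityʳ q))) q+en≡P
cost-lower-bound {h} {n} {P} q true n≡h+h 1≤h h≤P P≤1+h q+en≡P =
  ℕP.≤-trans h≤1+j (ℕP.≤-trans (s≤s j≤∣q∣) (ℕP.≤-reflexive (ℕP.+-comm 1 ∣ q ∣)))
  where j = n ℕ.∸ P
        P+j≡n : P ℕ.+ j ≡ n
        P+j≡n = ℕP.m+[n∸m]≡n (≤-double n≡h+h 1≤h P≤1+h)
        q≡-j : q ≡ - + j mod (+ 2 * + n)
        q≡-j = mod-trans (mod-reflexive (lemma q (+ n)))
                 (mod-trans (+-cong-mod q+en≡P mod-refl)
                   (mod-reflexive (trans (cong (λ t → + P - + t) (sym P+j≡n))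
                     (trans (cong (λ t → + P - t) (ℤP.pos-+ P j)) (lemma′ (+ P) (+ j))))))
          where lemma : ∀ q n → q ≡ (q + + 1 * n) - n
                lemma = solve-∀
                lemma′ : ∀ p j → p - (p + j) ≡ - j
                lemma′ = solve-∀
        j≤∣q∣ : j ≤ ∣ q ∣
        j≤∣q∣ = subst (_≤ ∣ q ∣) (ℤP.∣-i∣≡∣i∣ (+ j)) (least-residue ∣-j∣≤n q≡-j)
          where ∣-j∣≤n : ∣ - + j ∣ ≤ n
                ∣-j∣≤n = subst (_≤ n) (sym (ℤP.∣-i∣≡∣i∣ (+ j))) (subst (j ≤_) P+j≡n (ℕP.m≤n+m j P))
        h≤1+j : h ≤ suc j
        h≤1+j = ℕP.+-cancelˡ-≤ h h (suc j) (begin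
          h ℕ.+ h       ≡⟨ trans (sym n≡h+h) (sym P+j≡n) ⟩
          P ℕ.+ j       ≤⟨ ℕP.+-monoˡ-≤ j P≤1+h ⟩
          suc h ℕ.+ j   ≡⟨ ℕP.+-suc h j ⟨
          h ℕ.+ suc j   ∎)
          where open ℕP.≤-Reasoning

position-cases : ∀ {h n} p → n ≡ h ℕ.+ h → p < 2 ℕ.* n →
                 p ≤ h
                 ⊎ (Σ ℕ λ j → j < h × p ℕ.+ j ≡ n)
                 ⊎ (Σ ℕ λ j → j < h × n ℕ.+ j ≡ p)
                 ⊎ (Σ ℕ λ j → j ≤ h × p ℕ.+ j ≡ 2 ℕ.* n)
position-cases {h} {n} p n≡h+h p<2n with p ℕ.≤? h | p ℕ.≤? n | p ℕ.<? n ℕ.+ h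
... | yes p≤h | _ | _ = inj₁ p≤h
... | no p≰h | yes p≤n | _ = inj₂ (inj₁ (n ℕ.∸ p , ℕP.+-cancelˡ-< p _ _ (begin-strict
  p ℕ.+ (n ℕ.∸ p)   ≡⟨ ℕP.m+[n∸m]≡n p≤n ⟩
  n                 ≡⟨ n≡h+h ⟩
  h ℕ.+ h           <⟨ ℕP.+-monoˡ-< h (ℕP.≰⇒> p≰h) ⟩
  p ℕ.+ h           ∎) , ℕP.m+[n∸m]≡n p≤n))
  where open ℕP.≤-Reasoning
... | no _ | no p≰n | yes p<n+h = inj₂ (inj₂ (inj₁ (p ℕ.∸ n , ℕP.+-cancelˡ-< n _ _ (begin-strict
  n ℕ.+ (p ℕ.∸ n)   ≡⟨ ℕP.m+[n∸m]≡n n≤p ⟩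
  p                 <⟨ p<n+h ⟩
  n ℕ.+ h           ∎) , ℕP.m+[n∸m]≡n n≤p)))
  where open ℕP.≤-Reasoning
        n≤p = ℕP.<⇒≤ (ℕP.≰⇒> p≰n)
... | no _ | no _ | no p≮n+h = inj₂ (inj₂ (inj₂ (2 ℕ.* n ℕ.∸ p , ℕP.+-cancelˡ-≤ p _ _ (begin
  p ℕ.+ (2 ℕ.* n ℕ.∸ p) ≡⟨ ℕP.m+[n∸m]≡n (ℕP.<⇒≤ p<2n) ⟩
  2 ℕ.* n               ≡⟨ cong (n ℕ.+_) (trans (ℕP.+-identityʳ n) n≡h+h) ⟩
  n ℕ.+ (h ℕ.+ h)       ≡⟨ ℕP.+-assoc n h h ⟨
  n ℕ.+ h ℕ.+ h         ≤⟨ ℕP.+-monoˡ-≤ h (ℕP.≮⇒≥ p≮n+h) ⟩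
  p ℕ.+ h               ∎) , ℕP.m+[n∸m]≡n (ℕP.<⇒≤ p<2n))))
  where open ℕP.≤-Reasoning

-- Word length in the dihedral group

module Words (n : ℕ) .{{_ : NonZero n}} where
  open Dihedral n

  Reachable : List D → ℕ → D → Set
  Reachable S L d = Σ (List D) λ w → w ⊆ S × length w ≤ L × prod w ≡ d

  LowerBound : List D → ℕ → D → Set
  LowerBound S L d = ∀ w → w ⊆ S → prod w ≡ d → L ≤ length w

  wordLength-≤ : ∀ {S d k L} → WordLength S d k → Reachable S L d → k ≤ L
  wordLength-≤ (_ , minimal) (w , w⊆S , w≤L , w≡d) = ℕP.≤-trans (minimal w w⊆S w≡d) w≤L

  wordLength-exact : ∀ {S d L} → Reachable S L d → LowerBound S L d → WordLength S d L
  wordLength-exact (w , w⊆S , w≤L , w≡d) lower = (w , w⊆S , ℕP.≤-antisym w≤L (lower w w⊆S w≡d) , w≡d) , lower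

  Lambda1-intro : ∀ {S L t} → (∀ d → Reachable S L d) → LowerBound S L t →
                  (Σ D λ g → Σ D λ s → s ∈ S × g · (s · inv g) ≡ t) → Lambda1 S L
  Lambda1-intro reach lower (g , s , s∈S , refl) =
    (λ g s k _ wl → wordLength-≤ wl (reach _)) , g , s , s∈S , wordLength-exact (reach _) lower

  Lambda2-intro : ∀ {S L t} → (∀ d → Reachable S L d) → LowerBound S L t →
                  (Σ D λ g → Σ D λ s → Σ D λ s′ → s ∈ S × s′ ∈ S × g · ((s · s′) · inv g) ≡ t) →
                  Lambda2 S L
  Lambda2-intro reach lower (g , s , s′ , s∈S , s′∈S , refl) =
    (λ g s s′ k _ _ wl → wordLength-≤ wl (reach _)) , g , s , s′ , s∈S , s′∈S , wordLength-exact (reach _) lower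

-- Coordinates on the dihedral group

module Coordinates (n : ℕ) .{{_ : NonZero n}} where
  open Dihedral n

  infix 30 r^_f^_
  r^_f^_ : ℤ → Bool → D
  r^ x f^ b = fromℕ< (n%ℕd<d x n) , b

  exponent : D → ℕ
  exponent d = toℕ (proj₁ d)

  exponent-mod : ∀ x b → + exponent (r^ x f^ b) ≡ x mod + n
  exponent-mod x b = subst (λ k → + k ≡ x mod + n) (sym (FinP.toℕ-fromℕ< (n%ℕd<d x n))) (%ℕ-mod x n)

  r^-cong : ∀ {x y} b → x ≡ y mod + n → r^ x f^ b ≡ r^ y f^ b
  r^-cong {x} {y} b x≡y = cong (_, b) (FinP.toℕ-injective (residue-unique (FinP.toℕ<n _) (FinP.toℕ<n _)
    (mod-trans (exponent-mod x b) (mod-trans x≡y (mod-sym (exponent-mod y b))))))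

  r^-injective : ∀ {x y b c} → r^ x f^ b ≡ r^ y f^ c → x ≡ y mod + n
  r^-injective {x} {y} {b} {c} eq = mod-trans (mod-sym (exponent-mod x b))
    (mod-trans (mod-reflexive (cong (λ d → + exponent d) eq)) (exponent-mod y c))

  r^-toℕ : ∀ (i : Fin n) b → (i , b) ≡ r^ (+ toℕ i) f^ b
  r^-toℕ i b = cong (_, b) (FinP.toℕ-injective (sym (trans (FinP.toℕ-fromℕ< _) (ℕ÷.m<n⇒m%n≡m (FinP.toℕ<n i)))))

  negMod-mod : ∀ i → + negMod i ≡ - + toℕ i mod + n
  negMod-mod i = multiple 1ℤ (trans (lemma (+ negMod i) (+ toℕ i)) (cong (λ t → - + toℕ i + 1ℤ * t) sum≡n))
    where lemma : ∀ u t → u ≡ - t + 1ℤ * (u + t)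
          lemma = solve-∀
          sum≡n : + negMod i + + toℕ i ≡ + n
          sum≡n = trans (sym (ℤP.pos-+ (negMod i) (toℕ i))) (cong +_ (ℕP.m∸n+n≡m (ℕP.<⇒≤ (FinP.toℕ<n i))))

  ·-rotation : ∀ x y c → r^ x f^ false · r^ y f^ c ≡ r^ (x + y) f^ c
  ·-rotation x y c = r^-cong c
    (mod-trans (mod-reflexive (ℤP.pos-+ (exponent (r^ x f^ false)) (exponent (r^ y f^ c))))
      (+-cong-mod (exponent-mod x false) (exponent-mod y c)))

  ·-reflection : ∀ x y c → r^ x f^ true · r^ y f^ c ≡ r^ (x - y) f^ (not c)
  ·-reflection x y c = r^-cong (not c)
    (mod-trans (mod-reflexive (ℤP.pos-+ (exponent (r^ x f^ true)) (negMod (proj₁ (r^ y f^ c)))))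
      (+-cong-mod (exponent-mod x true) (mod-trans (negMod-mod _) (neg-cong-mod (exponent-mod y c)))))

  inv-rotation : ∀ x → inv (r^ x f^ false) ≡ r^ (- x) f^ false
  inv-rotation x = r^-cong false (mod-trans (negMod-mod _) (neg-cong-mod (exponent-mod x false)))

  pow-rotation : ∀ x m → pow (r^ x f^ false) m ≡ r^ (+ m * x) f^ false
  pow-rotation x zero = r^-cong false (mod-reflexive (sym (ℤP.*-zeroˡ x)))
  pow-rotation x (suc m) = begin
    r^ x f^ false · pow (r^ x f^ false) m ≡⟨ cong (r^ x f^ false ·_) (pow-rotation x m) ⟩
    r^ x f^ false · r^ (+ m * x) f^ false ≡⟨ ·-rotation x (+ m * x) false ⟩
    r^ (x + + m * x) f^ false           ≡⟨ r^-cong false (mod-reflexive (lemma x (+ m))) ⟩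
    r^ (+ suc m * x) f^ false           ∎
    where open ≡-Reasoning
          lemma : ∀ x m → x + m * x ≡ (1ℤ + m) * x
          lemma = solve-∀

  zpow-r : ∀ a → zpow r a ≡ r^ a f^ false
  zpow-r (+ m) = trans (pow-rotation 1ℤ m) (r^-cong false (mod-reflexive (ℤP.*-identityʳ (+ m))))
  zpow-r -[1+ m ] = trans (cong (λ g → pow g (suc m)) (inv-rotation 1ℤ))
    (trans (pow-rotation (- 1ℤ) (suc m)) (r^-cong false (mod-reflexive (lemma (+ suc m)))))
    where lemma : ∀ k → k * - 1ℤ ≡ - k
          lemma = solve-∀

module _ (n : ℕ) .{{_ : NonZero n}} where
  open Dihedral n
  open Coordinates n

  rotation-generator-inverse : ∀ {a} → GeneratesRotations (zpow r a) → Σ ℕ λ M → + M * a ≡ 1ℤ mod + n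
  rotation-generator-inverse {a} gen with gen 1
  ... | M , ρ^M≡r = M , r^-injective (begin
    r^ (+ M * a) f^ false    ≡⟨ pow-rotation a M ⟨
    pow (r^ a f^ false) M    ≡⟨ cong (λ g → pow g M) (zpow-r a) ⟨
    pow (zpow r a) M         ≡⟨ ρ^M≡r ⟩
    pow r 1                  ≡⟨ pow-rotation 1ℤ 1 ⟩
    r^ (+ 1 * 1ℤ) f^ false   ∎)
    where open ≡-Reasoning

module TwistedCoordinates (n : ℕ) .{{_ : NonZero n}} (a : ℤ) (M : ℕ) (Ma≡1 : + M * a ≡ 1ℤ mod + n) where
  open Dihedral n
  open Coordinates n

  infix 30 ρ^_f^_
  ρ^_f^_ : ℤ → Bool → D
  ρ^ x f^ b = r^ (x * a) f^ b

  ρ^-cong : ∀ {x y} b → x ≡ y mod + n → ρ^ x f^ b ≡ ρ^ y f^ b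
  ρ^-cong b x≡y = r^-cong b (*-congʳ-mod a x≡y)

  ρ^-injective : ∀ {x y b c} → ρ^ x f^ b ≡ ρ^ y f^ c → x ≡ y mod + n
  ρ^-injective {x} {y} eq = begin
    x                ≡⟨ ℤP.*-identityˡ x ⟨
    1ℤ * x           ≈⟨ *-congʳ-mod x (mod-sym Ma≡1) ⟩
    (+ M * a) * x    ≡⟨ lemma x ⟩
    (x * a) * + M    ≈⟨ *-congʳ-mod (+ M) (r^-injective {x * a} {y * a} eq) ⟩
    (y * a) * + M    ≡⟨ lemma y ⟨
    (+ M * a) * y    ≈⟨ *-congʳ-mod y Ma≡1 ⟩
    1ℤ * y           ≡⟨ ℤP.*-identityˡ y ⟩
    y                ∎
    where open ModReasoning (+ n)
          lemma : ∀ x → (+ M * a) * x ≡ (x * a) * + M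
          lemma x = commute (+ M) a x
            where commute : ∀ m a x → (m * a) * x ≡ (x * a) * m
                  commute = solve-∀

  ρ^-surjective : ∀ (d : D) → Σ ℤ λ x → d ≡ ρ^ x f^ proj₂ d
  ρ^-surjective (i , b) = + toℕ i * + M , trans (r^-toℕ i b) (r^-cong b (begin
    + toℕ i                 ≡⟨ ℤP.*-identityˡ (+ toℕ i) ⟨
    1ℤ * + toℕ i            ≈⟨ *-congʳ-mod (+ toℕ i) (mod-sym Ma≡1) ⟩
    (+ M * a) * + toℕ i     ≡⟨ lemma (+ M) a (+ toℕ i) ⟩
    + toℕ i * + M * a       ∎))
    where open ModReasoning (+ n)
          lemma : ∀ m a t → (m * a) * t ≡ t * m * a
          lemma = solve-∀

  ·-ρ-rotation : ∀ x y c → ρ^ x f^ false · ρ^ y f^ c ≡ ρ^ (x + y) f^ c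
  ·-ρ-rotation x y c = trans (·-rotation (x * a) (y * a) c) (cong (λ t → r^ t f^ c) (sym (ℤP.*-distribʳ-+ a x y)))

  ·-ρ-reflection : ∀ x y c → ρ^ x f^ true · ρ^ y f^ c ≡ ρ^ (x - y) f^ (not c)
  ·-ρ-reflection x y c = trans (·-reflection (x * a) (y * a) (c)) (cong (λ t → r^ t f^ not c) (lemma x y a))
    where lemma : ∀ x y a → x * a - y * a ≡ (x - y) * a
          lemma = solve-∀

  inv-ρ-rotation : ∀ x → inv (ρ^ x f^ false) ≡ ρ^ (- x) f^ false
  inv-ρ-rotation x = trans (inv-rotation (x * a)) (cong (λ t → r^ t f^ false) (ℤP.neg-distribˡ-* x a))

  conjugate-reflection : ∀ x y → ρ^ x f^ false · (ρ^ y f^ true · inv (ρ^ x f^ false)) ≡ ρ^ (y + + 2 * x) f^ true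
  conjugate-reflection x y = begin
    ρ^ x f^ false · (ρ^ y f^ true · inv (ρ^ x f^ false))
      ≡⟨ cong (λ g → ρ^ x f^ false · (ρ^ y f^ true · g)) (inv-ρ-rotation x) ⟩
    ρ^ x f^ false · (ρ^ y f^ true · ρ^ (- x) f^ false)
      ≡⟨ cong (ρ^ x f^ false ·_) (·-ρ-reflection y (- x) false) ⟩
    ρ^ x f^ false · ρ^ (y - - x) f^ true
      ≡⟨ ·-ρ-rotation x (y - - x) true ⟩
    ρ^ (x + (y - - x)) f^ true
      ≡⟨ cong (λ t → ρ^ t f^ true) (lemma x y) ⟩
    ρ^ (y + + 2 * x) f^ true
      ∎
    where open ≡-Reasoning
          lemma : ∀ x y → x + (y - - x) ≡ y + + 2 * x
          lemma = solve-∀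

-- The generating set f, r^a f, r^(n/2)

module Generators (n : ℕ) .{{_ : NonZero n}} (h : ℕ) (n≡h+h : n ≡ h ℕ.+ h)
               (a : ℤ) (M : ℕ) (Ma≡1 : + M * a ≡ 1ℤ mod + n) where
  open Dihedral n
  open Coordinates n
  open TwistedCoordinates n a M Ma≡1
  open Words n

  1≤h : 1 ≤ h
  1≤h = positive-half (ℕ.>-nonZero⁻¹ n) n≡h+h

  +n≡2h : + n ≡ + 2 * + h
  +n≡2h = trans (cong +_ (trans n≡h+h (cong (h ℕ.+_) (sym (ℕP.+-identityʳ h))))) (ℤP.pos-* 2 h)

  ρ z : D
  ρ = zpow r a
  z = pow r h

  S : List D
  S = f ∷ ρ · f ∷ z ∷ []

  z∈S : z ∈ S
  z∈S = there (there (here refl))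

  reflection : Bool → D
  reflection false = f
  reflection true  = ρ · f

  reflection∈S : ∀ c → reflection c ∈ S
  reflection∈S false = here refl
  reflection∈S true  = there (here refl)

  ρf≡ρ^1f : ρ · f ≡ ρ^ 1ℤ f^ true
  ρf≡ρ^1f = trans (cong (_· f) (zpow-r a)) (trans (·-rotation a 0ℤ true)
    (cong (λ t → r^ t f^ true) (trans (ℤP.+-identityʳ a) (sym (ℤP.*-identityˡ a)))))

  reflection≡ρ^ : ∀ c → reflection c ≡ ρ^ (+ bit c) f^ true
  reflection≡ρ^ false = refl
  reflection≡ρ^ true  = ρf≡ρ^1f

  z≡ρ^h : z ≡ ρ^ (+ h) f^ false
  z≡ρ^h = trans (pow-rotation 1ℤ h)
    (r^-cong false (mod-trans (mod-reflexive (ℤP.*-identityʳ (+ h))) (mod-sym a-fixes-h)))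
    where a-fixes-h : + h * a ≡ + h mod + n
          a-fixes-h = subst (λ k → + h * a ≡ + h mod k) (sym +n≡2h)
                        (unit-fixes-half {M = M} (subst (λ k → + M * a ≡ 1ℤ mod k) +n≡2h Ma≡1))

  position : ℤ → Bool → ℤ
  position x b = + 2 * x - + bit b

  infix 4 _isAt_
  _isAt_ : D → ℤ → Set
  d isAt p = Σ ℤ λ x → Σ Bool λ b → d ≡ ρ^ x f^ b × position x b ≡ p

  period : ℤ
  period = + 2 * + n

  isAt-≡ : ∀ {d p q} → d isAt p → p ≡ q → d isAt q
  isAt-≡ d-at refl = d-at

  rotation-isAt : ∀ x {d p} → d isAt p → ρ^ x f^ false · d isAt + 2 * x + p
  rotation-isAt x (y , b , refl , refl) = x + y , b , ·-ρ-rotation x y b , lemma x y (+ bit b)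
    where lemma : ∀ x y c → + 2 * (x + y) - c ≡ + 2 * x + (+ 2 * y - c)
          lemma = solve-∀

  reflection-isAt : ∀ x {d p} → d isAt p → ρ^ x f^ true · d isAt + 2 * x - 1ℤ - p
  reflection-isAt x (y , b , refl , refl) = x - y , not b , ·-ρ-reflection x y b ,
    trans (cong (λ c → + 2 * (x - y) - c) (bit-not b)) (lemma x y (+ bit b))
    where lemma : ∀ x y c → + 2 * (x - y) - (1ℤ - c) ≡ + 2 * x - 1ℤ - (+ 2 * y - c)
          lemma = solve-∀

  f-isAt : ∀ {d p} → d isAt p → f · d isAt - 1ℤ - p
  f-isAt = reflection-isAt 0ℤ

  ρf-isAt : ∀ {d p} → d isAt p → (ρ · f) · d isAt 1ℤ - p
  ρf-isAt {d} {p} d-at = subst (λ s → s · d isAt 1ℤ - p) (sym ρf≡ρ^1f) (reflection-isAt 1ℤ d-at)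

  z-isAt : ∀ {d p} → d isAt p → z · d isAt + n + p
  z-isAt {d} {p} d-at = subst (λ s → s · d isAt + n + p) (sym z≡ρ^h)
    (isAt-≡ (rotation-isAt (+ h) d-at) (cong (_+ p) (sym +n≡2h)))

  isAt-shift : ∀ {d p q} → d isAt p → q ≡ p mod period → d isAt q
  isAt-shift (x , b , refl , refl) (multiple k refl) =
    x + k * + n , b , ρ^-cong {x} b (mod-sym (multiple k refl)) , lemma x k (+ n) (+ bit b)
    where lemma : ∀ x k n c → + 2 * (x + k * n) - c ≡ (+ 2 * x - c) + k * (+ 2 * n)
          lemma = solve-∀

  isAt-congruent : ∀ {d p q} → d isAt p → d isAt q → p ≡ q mod period
  isAt-congruent (x , b , refl , refl) (y , c , eq , refl) with cong proj₂ eq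
  ... | refl = +-cong-mod (scale-mod (+ 2) (ρ^-injective {x} {y} eq)) mod-refl

  position-injective : ∀ {x y b c} → position x b ≡ position y c → x ≡ y × b ≡ c
  position-injective {x} {y} {false} {false} eq = twice-injective {k = 0ℤ} eq , refl
  position-injective {x} {y} {true}  {true}  eq = twice-injective {k = 1ℤ} eq , refl
  position-injective {x} {y} {false} {true}  eq =
    ⊥-elim (twice≢1 (y - x) (trans (lemma x y) (trans (cong (λ t → + 2 * y - 1ℤ - t + 1ℤ) eq) (lemma′ y))))
    where lemma : ∀ x y → + 2 * (y - x) ≡ + 2 * y - 1ℤ - (+ 2 * x - 0ℤ) + 1ℤ
          lemma = solve-∀
          lemma′ : ∀ y → + 2 * y - 1ℤ - (+ 2 * y - 1ℤ) + 1ℤ ≡ 1ℤ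
          lemma′ = solve-∀
  position-injective {x} {y} {true}  {false} eq with position-injective {y} {x} {false} {true} (sym eq)
  ... | _ , ()

  isAt-injective : ∀ {d d′ p} → d isAt p → d′ isAt p → d ≡ d′
  isAt-injective (x , b , refl , refl) (y , c , refl , eq) with position-injective {x} {y} {b} {c} (sym eq)
  ... | x≡y , refl = ρ^-cong b (mod-reflexive x≡y)

  instance
    2n≢0 : NonZero (2 ℕ.* n)
    2n≢0 = ℕP.m*n≢0 2 n

  isAt-exists : ∀ d → Σ ℕ λ p → p < 2 ℕ.* n × d isAt + p
  isAt-exists d with ρ^-surjective d
  ... | x , d≡ρ^x = P %ℕ (2 ℕ.* n) , n%ℕd<d P (2 ℕ.* n) ,
        isAt-shift (x , proj₂ d , d≡ρ^x , refl) P%2n≡P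
    where P = position x (proj₂ d)
          P%2n≡P : + (P %ℕ (2 ℕ.* n)) ≡ P mod period
          P%2n≡P = subst (λ k → + (P %ℕ (2 ℕ.* n)) ≡ P mod k) (ℤP.pos-* 2 n) (%ℕ-mod P (2 ℕ.* n))

  WithinCost : ℕ → D → Set
  WithinCost L d = Σ ℤ λ q → Σ Bool λ e → d isAt q + + bit e * + n × ∣ q ∣ ℕ.+ bit e ≤ L

  withinCost-reflection : ∀ {s σ L d} → ∣ σ ∣ ≡ 1 → (∀ {d p} → d isAt p → s · d isAt σ - p) →
                          WithinCost L d → WithinCost (suc L) (s · d)
  withinCost-reflection {σ = σ} ∣σ∣≡1 s-isAt (q , e , d-at , cost) =
    σ - q , e , isAt-shift (s-isAt d-at) (multiple (+ bit e) (lemma σ q (+ bit e) (+ n))) ,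
    ℕP.≤-trans (ℕP.+-monoˡ-≤ (bit e) ∣σ-q∣≤1+∣q∣) (s≤s cost)
    where ∣σ-q∣≤1+∣q∣ : ∣ σ - q ∣ ≤ suc ∣ q ∣
          ∣σ-q∣≤1+∣q∣ = subst (λ k → ∣ σ - q ∣ ≤ k ℕ.+ ∣ q ∣) ∣σ∣≡1 (ℤP.∣i-j∣≤∣i∣+∣j∣ σ q)
          lemma : ∀ σ q e n → (σ - q) + e * n ≡ σ - (q + e * n) + e * (+ 2 * n)
          lemma = solve-∀

  withinCost-z : ∀ {L d} → WithinCost L d → WithinCost (suc L) (z · d)
  withinCost-z (q , false , d-at , cost) =
    q , true , isAt-≡ (z-isAt d-at) (lemma q (+ n)) ,
    ℕP.≤-trans (ℕP.≤-reflexive (ℕP.+-comm ∣ q ∣ 1)) (s≤s (ℕP.≤-trans (ℕP.m≤m+n ∣ q ∣ 0) cost))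
    where lemma : ∀ q n → n + (q + + 0 * n) ≡ q + + 1 * n
          lemma = solve-∀
  withinCost-z (q , true , d-at , cost) =
    q , false , isAt-shift (z-isAt d-at) (multiple (- 1ℤ) (lemma q (+ n))) ,
    ℕP.≤-trans (ℕP.+-monoʳ-≤ ∣ q ∣ z≤n) (ℕP.m≤n⇒m≤1+n cost)
    where lemma : ∀ q n → q + + 0 * n ≡ n + (q + + 1 * n) + - 1ℤ * (+ 2 * n)
          lemma = solve-∀

  withinCost-generator : ∀ {s L d} → s ∈ S → WithinCost L d → WithinCost (suc L) (s · d)
  withinCost-generator (here refl)                 = withinCost-reflection {f} { - 1ℤ} refl f-isAt
  withinCost-generator (there (here refl))         = withinCost-reflection {ρ · f} {1ℤ} refl ρf-isAt
  withinCost-generator (there (there (here refl))) = withinCost-z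

  withinCost-prod : ∀ w → w ⊆ S → WithinCost (length w) (prod w)
  withinCost-prod []      _     = 0ℤ , false , (0ℤ , false , refl , refl) , z≤n
  withinCost-prod (s ∷ w) s∷w⊆S =
    withinCost-generator (s∷w⊆S (here refl)) (withinCost-prod w (λ x∈w → s∷w⊆S (there x∈w)))

  m : ℕ
  m = proj₁ (odd-neighbour h)

  h≤2m+1 : h ≤ suc (2 ℕ.* m)
  h≤2m+1 = proj₁ (proj₂ (odd-neighbour h))

  2m+1≤h+1 : suc (2 ℕ.* m) ≤ suc h
  2m+1≤h+1 = proj₂ (proj₂ (odd-neighbour h))

  target : D
  target = ρ^ (+ suc m) f^ true

  target-isAt : target isAt + suc (2 ℕ.* m)
  target-isAt = + suc m , true , refl , trans (lemma (+ m)) (cong (λ t → 1ℤ + t) (sym (ℤP.pos-* 2 m)))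
    where lemma : ∀ k → + 2 * (1ℤ + k) - 1ℤ ≡ 1ℤ + + 2 * k
          lemma = solve-∀

  target-lower-bound : LowerBound S h target
  target-lower-bound w w⊆S w≡target with withinCost-prod w w⊆S
  ... | q , e , w-at , cost = ℕP.≤-trans
        (cost-lower-bound q e n≡h+h 1≤h h≤2m+1 2m+1≤h+1 (isAt-congruent w-at (subst (_isAt _) (sym w≡target) target-isAt)))
        cost

  ∷-⊆S : ∀ {s w} → s ∈ S → w ⊆ S → (s ∷ w) ⊆ S
  ∷-⊆S s∈S w⊆S (here refl)  = s∈S
  ∷-⊆S s∈S w⊆S (there x∈w) = w⊆S x∈w

  up down : ℕ → List D
  up zero       = []
  up (suc k)    = ρ · f ∷ down k
  down zero     = []
  down (suc k)  = f ∷ up k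

  up-isAt : ∀ k → prod (up k) isAt + k
  down-isAt : ∀ k → prod (down k) isAt - + k
  up-isAt zero      = 0ℤ , false , refl , refl
  up-isAt (suc k)   = isAt-≡ (ρf-isAt (down-isAt k)) (cong (λ t → 1ℤ + t) (ℤP.neg-involutive (+ k)))
  down-isAt zero    = 0ℤ , false , refl , refl
  down-isAt (suc k) = isAt-≡ (f-isAt (up-isAt k)) (lemma (+ k))
    where lemma : ∀ k → - 1ℤ - k ≡ - (1ℤ + k)
          lemma = solve-∀

  length-up : ∀ k → length (up k) ≡ k
  length-down : ∀ k → length (down k) ≡ k
  length-up zero      = refl
  length-up (suc k)   = cong suc (length-down k)
  length-down zero    = refl
  length-down (suc k) = cong suc (length-up k)

  up⊆S : ∀ k → up k ⊆ S
  down⊆S : ∀ k → down k ⊆ S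
  up⊆S zero ()
  up⊆S (suc k) = ∷-⊆S (there (here refl)) (down⊆S k)
  down⊆S zero ()
  down⊆S (suc k) = ∷-⊆S (here refl) (up⊆S k)

  reachable-by : ∀ {d p q} w → w ⊆ S → length w ≤ h → prod w isAt q → d isAt p → p ≡ q mod period →
                 Reachable S h d
  reachable-by w w⊆S w≤h w-at d-at p≡q = w , w⊆S , w≤h , isAt-injective (isAt-shift w-at p≡q) d-at

  reachable : ∀ d → Reachable S h d
  reachable d with isAt-exists d
  ... | p , p<2n , d-at with position-cases p n≡h+h p<2n
  ... | inj₁ p≤h = reachable-by (up p) (up⊆S p) (subst (_≤ h) (sym (length-up p)) p≤h) (up-isAt p) d-at mod-refl
  ... | inj₂ (inj₁ (j , j<h , p+j≡n)) =
        reachable-by (z ∷ down j) (∷-⊆S z∈S (down⊆S j)) (subst (_≤ h) (cong suc (sym (length-down j))) j<h)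
          (z-isAt (down-isAt j)) d-at
          (mod-reflexive (trans (lemma (+ p) (+ j)) (cong (_+ - + j) (trans (sym (ℤP.pos-+ p j)) (cong +_ p+j≡n)))))
    where lemma : ∀ p j → p ≡ (p + j) + - j
          lemma = solve-∀
  ... | inj₂ (inj₂ (inj₁ (j , j<h , n+j≡p))) =
        reachable-by (z ∷ up j) (∷-⊆S z∈S (up⊆S j)) (subst (_≤ h) (cong suc (sym (length-up j))) j<h)
          (z-isAt (up-isAt j)) d-at (mod-reflexive (sym (trans (sym (ℤP.pos-+ n j)) (cong +_ n+j≡p))))
  ... | inj₂ (inj₂ (inj₂ (j , j≤h , p+j≡2n))) =
        reachable-by (down j) (down⊆S j) (subst (_≤ h) (sym (length-down j)) j≤h) (down-isAt j) d-at
          (multiple 1ℤ (trans (lemma (+ p) (+ j)) (cong (λ t → - + j + 1ℤ * t)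
            (trans (sym (ℤP.pos-+ p j)) (trans (cong +_ p+j≡2n) (ℤP.pos-* 2 n))))))
    where lemma : ∀ p j → p ≡ - j + 1ℤ * (p + j)
          lemma = solve-∀

  target-conjugate₁ : Σ D λ g → Σ D λ s → s ∈ S × g · (s · inv g) ≡ target
  target-conjugate₁ with parity (suc m)
  ... | x , c , 1+m≡c+2x = g , reflection c , reflection∈S c , (begin
    g · (reflection c · inv g)
      ≡⟨ cong (λ s → g · (s · inv g)) (reflection≡ρ^ c) ⟩
    g · (ρ^ (+ bit c) f^ true · inv g)
      ≡⟨ conjugate-reflection (+ x) (+ bit c) ⟩
    ρ^ (+ bit c + + 2 * + x) f^ true
      ≡⟨ cong (λ t → ρ^ t f^ true) (trans (sym (pos-+-* (bit c) 2 x)) (cong +_ (sym 1+m≡c+2x))) ⟩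
    target
      ∎)
    where open ≡-Reasoning
          g = ρ^ + x f^ false

  target-conjugate₂ : Σ D λ g → Σ D λ s → Σ D λ s′ →
                      s ∈ S × s′ ∈ S × g · ((s · s′) · inv g) ≡ target
  target-conjugate₂ with parity (suc m ℕ.+ h)
  ... | x , c , 1+m+h≡c+2x = g , reflection c , z , reflection∈S c , z∈S , (begin
    g · ((reflection c · z) · inv g)
      ≡⟨ cong₂ (λ s t → g · ((s · t) · inv g)) (reflection≡ρ^ c) z≡ρ^h ⟩
    g · ((ρ^ (+ bit c) f^ true · ρ^ (+ h) f^ false) · inv g)
      ≡⟨ cong (λ s → g · (s · inv g)) (·-ρ-reflection (+ bit c) (+ h) false) ⟩
    g · (ρ^ (+ bit c - + h) f^ true · inv g)
      ≡⟨ conjugate-reflection (+ x) (+ bit c - + h) ⟩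
    ρ^ (+ bit c - + h + + 2 * + x) f^ true
      ≡⟨ cong (λ t → ρ^ t f^ true) exponent≡ ⟩
    target
      ∎)
    where open ≡-Reasoning
          g = ρ^ + x f^ false
          exponent≡ : + bit c - + h + + 2 * + x ≡ + suc m
          exponent≡ = begin
            + bit c - + h + + 2 * + x    ≡⟨ lemma (+ bit c) (+ h) (+ x) ⟩
            (+ bit c + + 2 * + x) - + h  ≡⟨ cong (_- + h) (trans (sym (pos-+-* (bit c) 2 x)) (cong +_ (sym 1+m+h≡c+2x))) ⟩
            + (suc m ℕ.+ h) - + h        ≡⟨ cong (_- + h) (ℤP.pos-+ (suc m) h) ⟩
            (+ suc m + + h) - + h        ≡⟨ lemma′ (+ suc m) (+ h) ⟩
            + suc m                      ∎
            where lemma : ∀ b h x → b - h + + 2 * x ≡ (b + + 2 * x) - h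
                  lemma = solve-∀
                  lemma′ : ∀ s h → (s + h) - h ≡ s
                  lemma′ = solve-∀

theorem8 : (n : ℕ) .{{nz : NonZero n}} → 4 ≤ n → 2 ∣ n → (a : ℤ) →
    Dihedral.GeneratesRotations n (Dihedral.zpow n (Dihedral.r n) a) →
    let S = Dihedral.f n ∷ (Dihedral._·_ n (Dihedral.zpow n (Dihedral.r n) a) (Dihedral.f n)) ∷ Dihedral.pow n (Dihedral.r n) (n / 2) ∷ [] in
    Dihedral.Lambda1 n S (n / 2) × Dihedral.Lambda2 n S (n / 2)
theorem8 n _ 2∣n a gen with rotation-generator-inverse n gen
... | M , Ma≡1 = Lambda1-intro reachable target-lower-bound target-conjugate₁ ,
                 Lambda2-intro reachable target-lower-bound target-conjugate₂
  where open Words n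
        open Generators n (n / 2) (half-double 2∣n) a M Ma≡1
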